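{- Let $D,R$ be positive integers with $R\le D$. Suppose $x$ is a $(D,R)$-periodic free word of length at most $D+R$. Then the $D$-letter contiguous substrings of $x$ starting at distinct positions are pairwise distinct.
   Context: A string $w$ is $p$-periodic if $w_i=w_{i+p}$ for all $i\in\{1,\dots,|w|-p\}$. A string is $(D,R)$-periodic (for $R\le D$) if it has length at least $D$ and is $p$-periodic for some period $p\le R$. A string is $(D,R)$-periodic free if none of its contiguous substrings is $(D,R)$-periodic. -}

module Defs where

open import Data.Nat using (ℕ; _+_; _≤_; _<_)
open import Data.List using (List; length; take; drop; lookup)
open import Data.Fin using (fromℕ<)
open import Data.Product using (Σ; _×_)
open import Relation.Binary.PropositionalEquality using (_≡_)
open import Relation.Nullary using (¬_)

-- Positions are 0-indexed: w is p-periodic iff w[i] = w[i+p] for all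
-- 0 ≤ i with i + p < |w|  (the paper's i ∈ {1,…,|w|-p}, shifted by one).
IsPeriodic : {A : Set} → ℕ → List A → Set
IsPeriodic {A} p w =
  (i : ℕ) (h₁ : i < length w) (h₂ : i + p < length w) →
  lookup w (fromℕ< h₁) ≡ lookup w (fromℕ< h₂)

DRPeriodic : {A : Set} → ℕ → ℕ → List A → Set
DRPeriodic D R w =
  D ≤ length w × Σ ℕ (λ p → (1 ≤ p) × (p ≤ R) × IsPeriodic p w)

substr : {A : Set} → ℕ → ℕ → List A → List A
substr i l w = take l (drop i w)

DRPeriodicFree : {A : Set} → ℕ → ℕ → List A → Set
DRPeriodicFree D R w = (i l : ℕ) → ¬ DRPeriodic D R (substr i l w)

module Submission where

-- Suppose the windows of length D at positions i < j = i + p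
-- coincide.  Then the window w = x[i, i+p+D) has its prefix of length D
-- equal to its suffix of length D, i.e. w has a border of length |w| - p,
-- and a word with a border of length |w| - p is p-periodic.  Since w lies
-- inside x we get i + p + D ≤ |x| ≤ D + R, hence 1 ≤ p ≤ R; and |w| ≥ D.
-- So w is a (D,R)-periodic substring of x, contradicting freeness.

open import Defs
open import Data.Nat using (ℕ; zero; suc; _+_; _∸_; _⊓_; _≤_; _<_; s≤s)
open import Data.Nat.Properties
open import Data.List using (List; []; _∷_; length; take; drop; lookup)
open import Data.List.Properties using (length-take; length-drop; take-take; take-drop; drop-drop)
open import Data.Fin using (fromℕ<)
open import Data.Maybe using (Maybe; just; nothing)
open import Data.Maybe.Properties using (just-injective)
open import Data.Product using (∃; _×_; _,_)
open import Relation.Binary.PropositionalEquality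
open import Relation.Binary.Definitions using (tri<; tri≈; tri>)

private
  variable
    A : Set

-- Total indexing: `lookup? w k` is the k-th letter of w, or nothing if
-- k ≥ |w|.  It commutes with take/drop without carrying bound proofs.
lookup? : List A → ℕ → Maybe A
lookup? []       _       = nothing
lookup? (a ∷ w)  zero    = just a
lookup? (a ∷ w)  (suc k) = lookup? w k

lookup?-lookup : (w : List A) (k : ℕ) (h : k < length w) →
                 lookup? w k ≡ just (lookup w (fromℕ< h))
lookup?-lookup (a ∷ w) zero    (s≤s h) = refl
lookup?-lookup (a ∷ w) (suc k) (s≤s h) = lookup?-lookup w k h

lookup?-take : (w : List A) {l k : ℕ} → k < l → lookup? (take l w) k ≡ lookup? w k
lookup?-take []      {suc l} {k}     _       = refl
lookup?-take (a ∷ w) {suc l} {zero}  _       = refl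
lookup?-take (a ∷ w) {suc l} {suc k} (s≤s h) = lookup?-take w h

lookup?-drop : (w : List A) (p k : ℕ) → lookup? (drop p w) k ≡ lookup? w (k + p)
lookup?-drop w       zero    k = cong (lookup? w) (sym (+-identityʳ k))
lookup?-drop []      (suc p) k = refl
lookup?-drop (a ∷ w) (suc p) k =
  trans (lookup?-drop w p k) (cong (lookup? (a ∷ w)) (sym (+-suc k p)))

substr-length : (w : List A) (i l : ℕ) → i + l ≤ length w → length (substr i l w) ≡ l
substr-length w i l fits = begin
  length (take l (drop i w)) ≡⟨ length-take l (drop i w) ⟩
  l ⊓ length (drop i w)      ≡⟨ cong (l ⊓_) (length-drop i w) ⟩
  l ⊓ (length w ∸ i)         ≡⟨ m≤n⇒m⊓n≡m l≤rest ⟩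
  l                          ∎
  where
  open ≡-Reasoning
  l≤rest : l ≤ length w ∸ i
  l≤rest = subst (_≤ length w ∸ i) (m+n∸m≡n i l) (∸-monoˡ-≤ i fits)

border-index : (w : List A) (p D k : ℕ) → take D w ≡ drop p w → k + p < length w → k < D
border-index w p D k border k+p<|w| = begin-strict
  k                     <⟨ m+n≤o⇒m≤o∸n (suc k) k+p<|w| ⟩
  length w ∸ p          ≡⟨ sym (length-drop p w) ⟩
  length (drop p w)     ≡⟨ cong length (sym border) ⟩
  length (take D w)     ≡⟨ length-take D w ⟩
  D ⊓ length w          ≤⟨ m⊓n≤m D (length w) ⟩
  D                     ∎
  where open ≤-Reasoning

border⇒periodic : (w : List A) (p D : ℕ) → take D w ≡ drop p w → IsPeriodic p w
border⇒periodic w p D border k k<|w| k+p<|w| = just-injective (begin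
  just (lookup w (fromℕ< k<|w|))     ≡⟨ sym (lookup?-lookup w k k<|w|) ⟩
  lookup? w k                        ≡⟨ sym (lookup?-take w (border-index w p D k border k+p<|w|)) ⟩
  lookup? (take D w) k               ≡⟨ cong (λ v → lookup? v k) border ⟩
  lookup? (drop p w) k               ≡⟨ lookup?-drop w p k ⟩
  lookup? w (k + p)                  ≡⟨ lookup?-lookup w (k + p) k+p<|w| ⟩
  just (lookup w (fromℕ< k+p<|w|))   ∎)
  where open ≡-Reasoning

equal-windows⇒periodic-window : (x : List A) (i p D : ℕ) →
  substr i D x ≡ substr (i + p) D x → IsPeriodic p (substr i (p + D) x)
equal-windows⇒periodic-window x i p D same =
  border⇒periodic (take (p + D) (drop i x)) p D (begin
    take D (take (p + D) (drop i x))   ≡⟨ take-take D (p + D) (drop i x) ⟩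
    take (D ⊓ (p + D)) (drop i x)      ≡⟨ cong (λ l → take l (drop i x)) (m≤n⇒m⊓n≡m (m≤n+m D p)) ⟩
    take D (drop i x)                  ≡⟨ same ⟩
    take D (drop (i + p) x)            ≡⟨ cong (take D) (sym (drop-drop i p x)) ⟩
    take D (drop p (drop i x))         ≡⟨ take-drop D p (drop i x) ⟩
    drop p (take (p + D) (drop i x))   ∎)
  where open ≡-Reasoning

-- In a (D,R)-periodic free word of length ≤ D + R, the length-D windows at
-- positions i and i + p (p ≥ 1) differ: otherwise the window of length p + D
-- at i would be a (D,R)-periodic substring.
no-equal-windows-at-distance : (D R : ℕ) (x : List A) →
  DRPeriodicFree D R x → length x ≤ D + R →
  (i p : ℕ) → 1 ≤ p → i + p + D ≤ length x →
  substr i D x ≢ substr (i + p) D x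
no-equal-windows-at-distance D R x free short i p 1≤p fits same =
  free i (p + D) (long-enough , p , 1≤p , p≤R ,
                  equal-windows⇒periodic-window x i p D same)
  where
  fits′ : i + (p + D) ≤ length x
  fits′ = subst (_≤ length x) (+-assoc i p D) fits

  long-enough : D ≤ length (substr i (p + D) x)
  long-enough = subst (D ≤_) (sym (substr-length x i (p + D) fits′)) (m≤n+m D p)

  p≤R : p ≤ R
  p≤R = +-cancelʳ-≤ D p R (begin
    p + D          ≤⟨ m≤n+m (p + D) i ⟩
    i + (p + D)    ≤⟨ fits′ ⟩
    length x       ≤⟨ short ⟩
    D + R          ≡⟨ +-comm D R ⟩
    R + D          ∎)
    where open ≤-Reasoning

positive-shift : {i j : ℕ} → i < j → ∃ λ p → 1 ≤ p × i + p ≡ j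
positive-shift {i} i<j = _ , m<n⇒0<n∸m i<j , m+[n∸m]≡n (<⇒≤ i<j)

lemma20 : {A : Set} (D R : ℕ) → 1 ≤ D → 1 ≤ R → R ≤ D →
    (x : List A) → DRPeriodicFree D R x → length x ≤ D + R →
    (i j : ℕ) → i + D ≤ length x → j + D ≤ length x → i ≢ j →
    substr i D x ≢ substr j D x
lemma20 D R _ _ _ x free short i j _ j-fits i≢j same with <-cmp i j
... | tri≈ _ i≡j _ = i≢j i≡j
... | tri< i<j _ _ with positive-shift i<j
...   | p , 1≤p , refl = no-equal-windows-at-distance D R x free short i p 1≤p j-fits same
lemma20 D R _ _ _ x free short i j i-fits _ _ same | tri> _ _ j<i with positive-shift j<i
...   | p , 1≤p , refl = no-equal-windows-at-distance D R x free short j p 1≤p i-fits (sym same)
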